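{- For every integer $n\ge 1$, \[f_{n+1}=(-1)^n\sum_{k=0}^n\sum_{i=0}^{\lfloor\frac{n-k}{2}\rfloor}(-2)^k{n-i\choose i}{n-2i\choose k}.\]
   Context: Fibonacci numbers: $f_{ -1}=1$, $f_0=0$, $f_1=1$, $f_{m+1}=f_m+f_{m-1}$. -}

module Defs where

open import Data.Nat as ℕ using (ℕ; zero; suc; _∸_; _/_)
open import Data.Nat.Combinatorics using (_C_)
open import Data.Integer as ℤ using (ℤ; +_; -[1+_])

fib : ℕ → ℕ
fib zero = 0
fib (suc zero) = 1
fib (suc (suc m)) = fib (suc m) ℕ.+ fib m

sumTo : ℕ → (ℕ → ℤ) → ℤ
sumTo zero g = g 0
sumTo (suc n) g = sumTo n g ℤ.+ g (suc n)

_^ℤ_ : ℤ → ℕ → ℤ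
x ^ℤ zero = + 1
x ^ℤ suc k = x ℤ.* (x ^ℤ k)

doubleSum : ℕ → ℤ
doubleSum n =
  sumTo n (λ k →
    sumTo ((n ∸ k) / 2) (λ i →
      (-[1+ 1 ] ^ℤ k) ℤ.* (+ ((n ∸ i) C i)) ℤ.* (+ ((n ∸ (2 ℕ.* i)) C k))))

-- Extend each inner sum to i ≤ n (the added terms vanish) and swap the two sums. The sum over k is
-- then the binomial expansion of (1 − 2)^(n − 2i), so the double sum equals (−1)^n Σ_i C(n − i, i).
-- These shallow diagonals of Pascal's triangle obey the Fibonacci recurrence by Pascal's rule.
module Submission where

open import Data.Integer as ℤ using (ℤ; +_; -[1+_]; _+_; _*_; 0ℤ; 1ℤ; -1ℤ)
import Data.Integer.Properties as ℤₚ
open import Data.Integer.Tactic.RingSolver using (solve-∀)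
open import Data.Nat as ℕ using (ℕ; zero; suc; _∸_; _/_; _≤_; _<_; _≥_; z≤n; s≤s; _≤?_; NonZero)
open import Data.Nat.Combinatorics using (_C_; k>n⇒nCk≡0; nCk+nC[k+1]≡[n+1]C[k+1])
open import Data.Nat.DivMod using (m/n≤m; m*n/n≡m; /-monoˡ-≤)
import Data.Nat.Properties as ℕₚ
open import Data.Sum using (inj₁; inj₂)
open import Relation.Binary.PropositionalEquality
open import Relation.Nullary using (yes; no)

open import Defs

sumTo-cong : ∀ n {f g : ℕ → ℤ} → (∀ j → j ≤ n → f j ≡ g j) → sumTo n f ≡ sumTo n g
sumTo-cong zero    f≗g = f≗g 0 z≤n
sumTo-cong (suc n) f≗g =
  cong₂ _+_ (sumTo-cong n (λ j j≤n → f≗g j (ℕₚ.m≤n⇒m≤1+n j≤n))) (f≗g (suc n) ℕₚ.≤-refl)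

sumTo-distrib-+ : ∀ n (f g : ℕ → ℤ) → sumTo n (λ j → f j + g j) ≡ sumTo n f + sumTo n g
sumTo-distrib-+ zero    f g = refl
sumTo-distrib-+ (suc n) f g =
  trans (cong (_+ (f (suc n) + g (suc n))) (sumTo-distrib-+ n f g)) (interchange (sumTo n f) (sumTo n g) (f (suc n)) (g (suc n)))
  where
  interchange : ∀ a b c d → (a + b) + (c + d) ≡ (a + c) + (b + d)
  interchange = solve-∀

sumTo-*ˡ : ∀ n c (f : ℕ → ℤ) → sumTo n (λ j → c * f j) ≡ c * sumTo n f
sumTo-*ˡ zero    c f = refl
sumTo-*ˡ (suc n) c f =
  trans (cong (_+ c * f (suc n)) (sumTo-*ˡ n c f)) (sym (ℤₚ.*-distribˡ-+ c (sumTo n f) (f (suc n))))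

sumTo-unfoldˡ : ∀ n (f : ℕ → ℤ) → sumTo (suc n) f ≡ f 0 + sumTo n (λ j → f (suc j))
sumTo-unfoldˡ zero    f = refl
sumTo-unfoldˡ (suc n) f =
  trans (cong (_+ f (suc (suc n))) (sumTo-unfoldˡ n f)) (ℤₚ.+-assoc (f 0) _ _)

sumTo-extend : ∀ {m N} (f : ℕ → ℤ) → m ≤ N → (∀ j → m < j → f j ≡ 0ℤ) → sumTo m f ≡ sumTo N f
sumTo-extend {N = zero}  f z≤n    vanish = refl
sumTo-extend {m} {suc N} f m≤1+N vanish with ℕₚ.m≤n⇒m<n∨m≡n m≤1+N
... | inj₂ refl  = refl
... | inj₁ m<1+N = begin
    sumTo m f             ≡⟨ sumTo-extend f (ℕₚ.≤-pred m<1+N) vanish ⟩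
    sumTo N f             ≡⟨ sym (ℤₚ.+-identityʳ (sumTo N f)) ⟩
    sumTo N f + 0ℤ        ≡⟨ cong (_+_ (sumTo N f)) (sym (vanish (suc N) m<1+N)) ⟩
    sumTo (suc N) f       ∎
  where open ≡-Reasoning

sumTo-comm : ∀ n m (h : ℕ → ℕ → ℤ) →
             sumTo n (λ k → sumTo m (h k)) ≡ sumTo m (λ i → sumTo n (λ k → h k i))
sumTo-comm zero    m h = refl
sumTo-comm (suc n) m h =
  trans (cong (_+ sumTo m (h (suc n))) (sumTo-comm n m h))
        (sym (sumTo-distrib-+ m (λ i → sumTo n (λ k → h k i)) (h (suc n))))

binomial-theorem : ∀ (x : ℤ) m {N} → m ≤ N → sumTo N (λ k → x ^ℤ k * + (m C k)) ≡ (1ℤ + x) ^ℤ m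
binomial-theorem x zero    {N} _ =
  sym (sumTo-extend {N = N} (λ k → x ^ℤ k * + (0 C k)) z≤n
         λ { zero () ; (suc k) _ → ℤₚ.*-zeroʳ (x ^ℤ suc k) })
binomial-theorem x (suc m) {suc N} (s≤s m≤N) = begin
    sumTo (suc N) (term (suc m))
  ≡⟨ sumTo-unfoldˡ N (term (suc m)) ⟩
    1ℤ + sumTo N (λ k → term (suc m) (suc k))
  ≡⟨ cong (_+_ 1ℤ) (sumTo-cong N λ k _ → pascal k) ⟩
    1ℤ + sumTo N (λ k → x * term m k + term m (suc k))
  ≡⟨ cong (_+_ 1ℤ) (sumTo-distrib-+ N _ _) ⟩
    1ℤ + (sumTo N (λ k → x * term m k) + tail)
  ≡⟨ cong (λ s → 1ℤ + (s + tail)) (sumTo-*ˡ N x (term m)) ⟩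
    1ℤ + (x * sumTo N (term m) + tail)
  ≡⟨ cong (λ s → 1ℤ + (x * s + tail)) (binomial-theorem x m m≤N) ⟩
    1ℤ + (x * y + tail)
  ≡⟨ swap-front (x * y) tail ⟩
    x * y + (1ℤ + tail)
  ≡⟨ cong (_+_ (x * y)) (trans (sym (sumTo-unfoldˡ N (term m)))
                            (binomial-theorem x m (ℕₚ.m≤n⇒m≤1+n m≤N))) ⟩
    x * y + y
  ≡⟨ factor x y ⟩
    (1ℤ + x) * y
  ∎
  where
  open ≡-Reasoning
  term : ℕ → ℕ → ℤ
  term m k = x ^ℤ k * + (m C k)
  y    = (1ℤ + x) ^ℤ m
  tail = sumTo N (λ k → term m (suc k))
  pascal : ∀ k → term (suc m) (suc k) ≡ x * term m k + term m (suc k)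
  pascal k = begin
      x ^ℤ suc k * + (suc m C suc k)
    ≡⟨ cong (λ c → x ^ℤ suc k * + c) (sym (nCk+nC[k+1]≡[n+1]C[k+1] m k)) ⟩
      x ^ℤ suc k * + (m C k ℕ.+ m C suc k)
    ≡⟨ cong (x ^ℤ suc k *_) (ℤₚ.pos-+ (m C k) (m C suc k)) ⟩
      x * x ^ℤ k * (+ (m C k) + + (m C suc k))
    ≡⟨ distrib x (x ^ℤ k) (+ (m C k)) (+ (m C suc k)) ⟩
      x * (x ^ℤ k * + (m C k)) + x ^ℤ suc k * + (m C suc k)
    ∎
    where
    distrib : ∀ a b c d → a * b * (c + d) ≡ a * (b * c) + a * b * d
    distrib = solve-∀
  swap-front : ∀ a b → 1ℤ + (a + b) ≡ a + (1ℤ + b)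
  swap-front = solve-∀
  factor : ∀ a b → a * b + b ≡ (1ℤ + a) * b
  factor = solve-∀

^ℤ-distribˡ-+-* : ∀ x m n → x ^ℤ (m ℕ.+ n) ≡ x ^ℤ m * x ^ℤ n
^ℤ-distribˡ-+-* x zero    n = sym (ℤₚ.*-identityˡ (x ^ℤ n))
^ℤ-distribˡ-+-* x (suc m) n = trans (cong (x *_) (^ℤ-distribˡ-+-* x m n)) (sym (ℤₚ.*-assoc x _ _))

^ℤ≗^ : ∀ x k → x ^ℤ k ≡ x ℤ.^ k
^ℤ≗^ x zero    = refl
^ℤ≗^ x (suc k) = cong (x *_) (^ℤ≗^ x k)

-1^ℤ-even : ∀ i → -1ℤ ^ℤ (2 ℕ.* i) ≡ 1ℤ
-1^ℤ-even i = trans (^ℤ≗^ -1ℤ (2 ℕ.* i)) (trans (sym (ℤₚ.^-*-assoc -1ℤ 2 i)) (ℤₚ.^-zeroˡ i))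

-1^ℤ-square : ∀ n → -1ℤ ^ℤ n * -1ℤ ^ℤ n ≡ 1ℤ
-1^ℤ-square n = begin
  -1ℤ ^ℤ n * -1ℤ ^ℤ n   ≡⟨ sym (^ℤ-distribˡ-+-* -1ℤ n n) ⟩
  -1ℤ ^ℤ (n ℕ.+ n)      ≡⟨ cong (λ e → -1ℤ ^ℤ (n ℕ.+ e)) (sym (ℕₚ.+-identityʳ n)) ⟩
  -1ℤ ^ℤ (2 ℕ.* n)      ≡⟨ -1^ℤ-even n ⟩
  1ℤ                    ∎
  where open ≡-Reasoning

-1^ℤ-∸-even : ∀ {n} i → 2 ℕ.* i ≤ n → -1ℤ ^ℤ (n ∸ 2 ℕ.* i) ≡ -1ℤ ^ℤ n
-1^ℤ-∸-even {n} i 2i≤n = begin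
  -1ℤ ^ℤ (n ∸ 2 ℕ.* i)                           ≡⟨ sym (ℤₚ.*-identityˡ _) ⟩
  1ℤ * -1ℤ ^ℤ (n ∸ 2 ℕ.* i)                      ≡⟨ cong (_* -1ℤ ^ℤ (n ∸ 2 ℕ.* i)) (sym (-1^ℤ-even i)) ⟩
  -1ℤ ^ℤ (2 ℕ.* i) * -1ℤ ^ℤ (n ∸ 2 ℕ.* i)        ≡⟨ sym (^ℤ-distribˡ-+-* -1ℤ (2 ℕ.* i) _) ⟩
  -1ℤ ^ℤ (2 ℕ.* i ℕ.+ (n ∸ 2 ℕ.* i))             ≡⟨ cong (-1ℤ ^ℤ_) (ℕₚ.m+[n∸m]≡n 2i≤n) ⟩
  -1ℤ ^ℤ n                                       ∎
  where open ≡-Reasoning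

m/n<o⇒m<n*o : ∀ {m o} n .{{_ : NonZero n}} → m / n < o → m < n ℕ.* o
m/n<o⇒m<n*o {m} {o} n m/n<o = ℕₚ.≰⇒> λ n*o≤m → ℕₚ.<⇒≱ m/n<o (begin
  o                 ≡⟨ sym (m*n/n≡m o n) ⟩
  o ℕ.* n / n       ≡⟨ cong (_/ n) (ℕₚ.*-comm o n) ⟩
  n ℕ.* o / n       ≤⟨ /-monoˡ-≤ n n*o≤m ⟩
  m / n             ∎)
  where open ℕₚ.≤-Reasoning

m<2n⇒m∸n<n : ∀ {m} n → m < 2 ℕ.* n → m ∸ n < n
m<2n⇒m∸n<n zero ()
m<2n⇒m∸n<n {m} n@(suc _) m<2n =
  ℕₚ.m<n+o⇒m∸n<o m n (subst (m <_) (cong (n ℕ.+_) (ℕₚ.+-identityʳ n)) m<2n)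

m∸n<o⇒m∸o<n : ∀ {m n o} → o ≤ m → m ∸ n < o → m ∸ o < n
m∸n<o⇒m∸o<n {m} {n} o≤m m∸n<o =
  ℕₚ.∸-cancelʳ-< (subst (m ∸ n <_) (sym (ℕₚ.m∸[m∸n]≡n o≤m)) m∸n<o)

n<2i⇒[n∸i]Ci≡0 : ∀ {n} i → n < 2 ℕ.* i → (n ∸ i) C i ≡ 0
n<2i⇒[n∸i]Ci≡0 i n<2i = k>n⇒nCk≡0 (m<2n⇒m∸n<n i n<2i)

-- Truncated subtraction makes this hold for every i: for i > n both sides are 0.
[1+n∸i]C[1+i]-pascal : ∀ n i → (suc n ∸ i) C suc i ≡ (n ∸ i) C i ℕ.+ (n ∸ i) C suc i
[1+n∸i]C[1+i]-pascal n i with i ≤? n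
... | yes i≤n =
  trans (cong (_C suc i) (ℕₚ.+-∸-assoc 1 i≤n)) (sym (nCk+nC[k+1]≡[n+1]C[k+1] (n ∸ i) i))
... | no  i≰n rewrite ℕₚ.m≤n⇒m∸n≡0 (ℕₚ.≰⇒> i≰n) | ℕₚ.m≤n⇒m∸n≡0 (ℕₚ.<⇒≤ (ℕₚ.≰⇒> i≰n)) =
  sym (trans (ℕₚ.+-identityʳ (0 C i)) (k>n⇒nCk≡0 (ℕₚ.<-≤-trans (s≤s z≤n) (ℕₚ.≰⇒> i≰n))))

diagonal : ℕ → ℕ → ℤ
diagonal n i = + ((n ∸ i) C i)

diagonalSum : ℕ → ℤ
diagonalSum n = sumTo n (diagonal n)

diagonalSum-extend : ∀ {n N} → n ≤ N → diagonalSum n ≡ sumTo N (diagonal n)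
diagonalSum-extend n≤N = sumTo-extend _ n≤N λ j n<j →
  cong +_ (n<2i⇒[n∸i]Ci≡0 j (ℕₚ.<-≤-trans n<j (ℕₚ.m≤m+n j _)))

diagonalSum≡fib : ∀ n → diagonalSum n ≡ + fib (suc n)
diagonalSum≡fib zero          = refl
diagonalSum≡fib (suc zero)    = refl
diagonalSum≡fib (suc (suc n)) = begin
    diagonalSum (suc (suc n))
  ≡⟨ sumTo-unfoldˡ (suc n) (diagonal (suc (suc n))) ⟩
    1ℤ + sumTo (suc n) (λ i → + ((suc n ∸ i) C suc i))
  ≡⟨ cong (_+_ 1ℤ) (sumTo-cong (suc n) λ i _ → pascal i) ⟩
    1ℤ + sumTo (suc n) (λ i → diagonal n i + above i)
  ≡⟨ cong (_+_ 1ℤ) (sumTo-distrib-+ (suc n) (diagonal n) above) ⟩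
    1ℤ + (sumTo (suc n) (diagonal n) + sumTo (suc n) above)
  ≡⟨ rotate (sumTo (suc n) (diagonal n)) (sumTo (suc n) above) ⟩
    (1ℤ + sumTo (suc n) above) + sumTo (suc n) (diagonal n)
  ≡⟨ cong (_+ sumTo (suc n) (diagonal n)) (sym (sumTo-unfoldˡ (suc n) (diagonal (suc n)))) ⟩
    sumTo (suc (suc n)) (diagonal (suc n)) + sumTo (suc n) (diagonal n)
  ≡⟨ cong₂ _+_ (sym (diagonalSum-extend (ℕₚ.n≤1+n (suc n)))) (sym (diagonalSum-extend (ℕₚ.n≤1+n n))) ⟩
    diagonalSum (suc n) + diagonalSum n
  ≡⟨ cong₂ _+_ (diagonalSum≡fib (suc n)) (diagonalSum≡fib n) ⟩
    + fib (suc (suc n)) + + fib (suc n)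
  ≡⟨ sym (ℤₚ.pos-+ (fib (suc (suc n))) (fib (suc n))) ⟩
    + fib (suc (suc (suc n)))
  ∎
  where
  open ≡-Reasoning
  above : ℕ → ℤ
  above i = + ((n ∸ i) C suc i)
  pascal : ∀ i → + ((suc n ∸ i) C suc i) ≡ diagonal n i + above i
  pascal i = trans (cong +_ ([1+n∸i]C[1+i]-pascal n i)) (ℤₚ.pos-+ ((n ∸ i) C i) ((n ∸ i) C suc i))
  rotate : ∀ a b → 1ℤ + (a + b) ≡ (1ℤ + b) + a
  rotate = solve-∀

summand : ℕ → ℕ → ℕ → ℤ
summand n k i = (-[1+ 1 ] ^ℤ k) * (+ ((n ∸ i) C i)) * (+ ((n ∸ (2 ℕ.* i)) C k))

summand-vanishes : ∀ n k i → n ∸ k < 2 ℕ.* i → summand n k i ≡ 0ℤ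
summand-vanishes n k i n∸k<2i with 2 ℕ.* i ≤? n
... | yes 2i≤n rewrite k>n⇒nCk≡0 (m∸n<o⇒m∸o<n {n} {k} 2i≤n n∸k<2i) =
  ℤₚ.*-zeroʳ (-[1+ 1 ] ^ℤ k * + ((n ∸ i) C i))
... | no  2i≰n rewrite n<2i⇒[n∸i]Ci≡0 i (ℕₚ.≰⇒> 2i≰n) =
  trans (cong (_* + ((n ∸ 2 ℕ.* i) C k)) (ℤₚ.*-zeroʳ (-[1+ 1 ] ^ℤ k))) (ℤₚ.*-zeroˡ (+ ((n ∸ 2 ℕ.* i) C k)))

sumTo-summand-extend : ∀ n k → sumTo ((n ∸ k) / 2) (summand n k) ≡ sumTo n (summand n k)
sumTo-summand-extend n k =
  sumTo-extend _ (ℕₚ.≤-trans (m/n≤m (n ∸ k) 2) (ℕₚ.m∸n≤m n k))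
    λ i ⌊[n∸k]/2⌋<i → summand-vanishes n k i (m/n<o⇒m<n*o 2 ⌊[n∸k]/2⌋<i)

sumTo-summand-over-k : ∀ n i → sumTo n (λ k → summand n k i) ≡ -1ℤ ^ℤ n * diagonal n i
sumTo-summand-over-k n i = begin
    sumTo n (λ k → summand n k i)
  ≡⟨ sumTo-cong n (λ k _ → regroup (-[1+ 1 ] ^ℤ k) c (+ ((n ∸ 2 ℕ.* i) C k))) ⟩
    sumTo n (λ k → c * (-[1+ 1 ] ^ℤ k * + ((n ∸ 2 ℕ.* i) C k)))
  ≡⟨ sumTo-*ˡ n c _ ⟩
    c * sumTo n (λ k → -[1+ 1 ] ^ℤ k * + ((n ∸ 2 ℕ.* i) C k))
  ≡⟨ cong (c *_) (binomial-theorem -[1+ 1 ] (n ∸ 2 ℕ.* i) (ℕₚ.m∸n≤m n (2 ℕ.* i))) ⟩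
    c * -1ℤ ^ℤ (n ∸ 2 ℕ.* i)
  ≡⟨ sign ⟩
    c * -1ℤ ^ℤ n
  ≡⟨ ℤₚ.*-comm c _ ⟩
    -1ℤ ^ℤ n * c
  ∎
  where
  open ≡-Reasoning
  c = diagonal n i
  regroup : ∀ a b d → a * b * d ≡ b * (a * d)
  regroup = solve-∀
  sign : + ((n ∸ i) C i) * -1ℤ ^ℤ (n ∸ 2 ℕ.* i) ≡ + ((n ∸ i) C i) * -1ℤ ^ℤ n
  sign with 2 ℕ.* i ≤? n
  ... | yes 2i≤n = cong (c *_) (-1^ℤ-∸-even i 2i≤n)
  ... | no  2i≰n rewrite n<2i⇒[n∸i]Ci≡0 i (ℕₚ.≰⇒> 2i≰n) = refl

doubleSum≡±diagonalSum : ∀ n → doubleSum n ≡ -1ℤ ^ℤ n * diagonalSum n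
doubleSum≡±diagonalSum n = begin
  doubleSum n                                            ≡⟨ sumTo-cong n (λ k _ → sumTo-summand-extend n k) ⟩
  sumTo n (λ k → sumTo n (summand n k))                  ≡⟨ sumTo-comm n n (summand n) ⟩
  sumTo n (λ i → sumTo n (λ k → summand n k i))          ≡⟨ sumTo-cong n (λ i _ → sumTo-summand-over-k n i) ⟩
  sumTo n (λ i → -1ℤ ^ℤ n * diagonal n i)                ≡⟨ sumTo-*ˡ n (-1ℤ ^ℤ n) _ ⟩
  -1ℤ ^ℤ n * diagonalSum n                               ∎
  where open ≡-Reasoning

-- The identity holds for n = 0 as well.
mainTheorem4 : (n : ℕ) → n ≥ 1 →
    + fib (suc n) ≡ (-[1+ 0 ] ^ℤ n) * doubleSum n
mainTheorem4 n _ = begin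
  + fib (suc n)               ≡⟨ sym (diagonalSum≡fib n) ⟩
  diagonalSum n               ≡⟨ sym (ℤₚ.*-identityˡ (diagonalSum n)) ⟩
  1ℤ * diagonalSum n          ≡⟨ cong (_* diagonalSum n) (sym (-1^ℤ-square n)) ⟩
  s * s * diagonalSum n       ≡⟨ ℤₚ.*-assoc s s (diagonalSum n) ⟩
  s * (s * diagonalSum n)     ≡⟨ cong (s *_) (sym (doubleSum≡±diagonalSum n)) ⟩
  s * doubleSum n             ∎
  where
  open ≡-Reasoning
  s = -1ℤ ^ℤ n
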